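{- Let $h\geq 3$ be an integer and let $A$ be a finite set of $k\geq 3$ positive integers. Then \[|h_{\pm}A| \geq 2hk-h+1.\] This lower bound is best possible: for $A=\{1,3,5,\ldots,2k-1\}$ one has $|h_{\pm}A| = 2hk-h+1$.
   Context: For a finite set $A=\{a_0,a_1,\ldots,a_{k-1}\}$ of integers and a positive integer $h$, the $h$-fold signed sumset of $A$ is \[h_{\pm}A=\Big\{\sum_{i=0}^{k-1}\lambda_i a_i : (\lambda_0,\ldots,\lambda_{k-1})\in\mathbb{Z}^k,\ \sum_{i=0}^{k-1}|\lambda_i|=h\Big\}.\] -}

module Defs where

open import Data.Nat using (ℕ; zero; suc)
open import Data.Integer using (ℤ; +_; _+_; _*_; ∣_∣)
import Data.Nat as N
open import Data.Fin using (Fin; zero; suc)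
open import Data.Product using (Σ; ∃; _×_)
open import Relation.Binary.PropositionalEquality using (_≡_)
open import Function.Definitions using (Injective)

sumℕ : ∀ {k} → (Fin k → ℕ) → ℕ
sumℕ {zero}  f = 0
sumℕ {suc k} f = f zero N.+ sumℕ (λ i → f (suc i))

sumℤ : ∀ {k} → (Fin k → ℤ) → ℤ
sumℤ {zero}  f = + 0
sumℤ {suc k} f = f zero + sumℤ (λ i → f (suc i))

-- membership in the h-fold signed sumset h_± A, where A = {a_0,...,a_{k-1}}
-- is given by an (injective) enumeration a : Fin k → ℤ
SignedSumset : ∀ {k} → ℕ → (Fin k → ℤ) → ℤ → Set
SignedSumset {k} h a x =
  Σ (Fin k → ℤ) λ l → (sumℕ (λ i → ∣ l i ∣) ≡ h) × (sumℤ (λ i → l i * a i) ≡ x)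

HasCard : (ℤ → Set) → ℕ → Set
HasCard S n =
  Σ (Fin n → ℤ) λ f →
    Injective {A = Fin n} {B = ℤ} _≡_ _≡_ f × ((i : Fin n) → S (f i)) × ((x : ℤ) → S x → ∃ λ i → f i ≡ x)

{-# OPTIONS --safe #-}
module Submission where

-- Sort A decreasingly and induct on k. When a new largest element m is added above the previous
-- maximum m′, the 2h sums ±(q m + (h − q) m′), 1 ≤ q ≤ h, are pairwise distinct and exceed in
-- absolute value the bound h m′ on every h-fold signed sum of the smaller elements, so at least 2h
-- new sums appear. For k = 3, with a < b < c, compare the gaps b − a and c − b. If they differ, a
-- chain of 3h positive sums is increasing because each step adds one of the gaps or their positive
-- difference; with the negated chain this gives 6h ≥ 5h + 1 sums. If A is an arithmetic progression,
-- a chain of 5h + 1 sums from −h c to h c, with steps b − a and 2a, is written down directly.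
-- For A = {1, 3, …, 2k − 1} every h-fold signed sum has the parity of h and lies in [−C, C] with
-- C = h (2k − 1), which leaves room for only C + 1 = 2hk − h + 1 values.

module SignedSums where

  open import Defs
  open import Data.Nat as ℕ using (ℕ; zero; suc; z≤n; s≤s)
  import Data.Nat.Properties as ℕₚ
  import Data.Nat.Literals as ℕLiterals
  import Data.Nat.Tactic.RingSolver as ℕSolver
  open import Data.Integer as ℤ using (ℤ; +_; -[1+_]; ∣_∣; _+_; _*_; -_; _-_; _<_; _≤_; _>_; +<+; +≤+; -≤+)
  import Data.Integer.Properties as ℤₚ
  import Data.Integer.Literals as ℤLiterals
  import Data.Integer.Tactic.RingSolver as ℤSolver
  open import Data.Fin using (Fin; zero; suc; toℕ; fromℕ<)
  import Data.Fin.Properties as Finₚ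
  open import Data.Vec using (Vec; toList; _∷_; [])
  import Data.Vec.Properties as Vecₚ
  open import Data.List using (List; []; _∷_; _++_; [_]; length; map; concatMap; lookup; tabulate; head; last)
  import Data.List.Properties as Listₚ
  open import Data.List.Membership.Propositional using (_∈_; find; lose)
  open import Data.List.Membership.Propositional.Properties
  open import Data.List.Relation.Unary.Any using (here; there; index)
  open import Data.List.Relation.Unary.Any.Properties using (lookup-index)
  open import Data.List.Relation.Unary.All as All using (All; []; _∷_)
  import Data.List.Relation.Unary.All.Properties as Allₚ
  open import Data.List.Relation.Unary.AllPairs as AllPairs using ([]; _∷_)
  import Data.List.Relation.Unary.AllPairs.Properties as AllPairsₚ
  open import Data.List.Relation.Unary.Linked using (Linked; []; [-]; _∷_)
  import Data.List.Relation.Unary.Linked.Properties as Linkedₚ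
  open import Data.List.Relation.Unary.Unique.Propositional using (Unique)
  import Data.List.Relation.Unary.Unique.Propositional.Properties as Uniqueₚ
  open import Data.List.Relation.Unary.Unique.DecPropositional.Properties using (deduplicate-!)
  open import Data.List.Relation.Binary.Permutation.Propositional as ↭ using (_↭_)
  import Data.List.Relation.Binary.Permutation.Propositional.Properties as ↭ₚ
  import Data.List.Relation.Binary.Permutation.Setoid.Properties as ↭ₛₚ
  open import Data.Maybe.Relation.Binary.Connected using (Connected; just; just-nothing)
  open import Data.Product using (Σ; ∃; _×_; _,_; proj₁; proj₂)
  open import Data.Empty using (⊥-elim)
  open import Data.Unit using (tt)
  open import Function using (_∘_)
  open import Function.Definitions using (Injective)
  open import Relation.Nullary using (yes; no)
  open import Relation.Binary.Definitions using (tri<; tri≈; tri>)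
  open import Relation.Binary.PropositionalEquality hiding ([_])
  import Relation.Binary.Construct.Flip.EqAndOrd as Flip
  open import Agda.Builtin.FromNat using (Number; fromNat)

  instance
    ℤ-number : Number ℤ
    ℤ-number = ℤLiterals.number
    ℕ-number : Number ℕ
    ℕ-number = ℕLiterals.number

  -- SignedSum h ys x: x = Σ lᵢ yᵢ with Σ ∣lᵢ∣ = h. Weight and value are fixed by equations rather
  -- than by index expressions, so that a sum can be produced at any index.
  data SignedSum : ℕ → List ℤ → ℤ → Set where
    []   : SignedSum 0 [] (+ 0)
    cons : ∀ {h h′ y ys x z} (l : ℤ) → SignedSum h′ ys x →
           h ≡ ∣ l ∣ ℕ.+ h′ → z ≡ l * y + x → SignedSum h (y ∷ ys) z

  SignedSum-resp-↭ : ∀ {h xs ys x} → xs ↭ ys → SignedSum h xs x → SignedSum h ys x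
  SignedSum-resp-↭ ↭.refl s = s
  SignedSum-resp-↭ (↭.prep y xs↭ys) (cons l s eh ex) = cons l (SignedSum-resp-↭ xs↭ys s) eh ex
  SignedSum-resp-↭ (↭.swap y z xs↭ys) (cons {x = x} l₁ (cons {h′ = h} {x = x′} l₂ s refl refl) refl refl) =
    cons l₂ (cons l₁ (SignedSum-resp-↭ xs↭ys s) refl refl) (exchangeℕ ∣ l₁ ∣ ∣ l₂ ∣ h) (exchangeℤ l₁ y l₂ z x′)
    where
    exchangeℕ : ∀ a b c → a ℕ.+ (b ℕ.+ c) ≡ b ℕ.+ (a ℕ.+ c)
    exchangeℕ = ℕSolver.solve-∀
    exchangeℤ : ∀ l₁ y l₂ z x → l₁ * y + (l₂ * z + x) ≡ l₂ * z + (l₁ * y + x)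
    exchangeℤ = ℤSolver.solve-∀
  SignedSum-resp-↭ (↭.trans xs↭ys ys↭zs) s = SignedSum-resp-↭ ys↭zs (SignedSum-resp-↭ xs↭ys s)

  SignedSum-neg : ∀ {h ys x} → SignedSum h ys x → SignedSum h ys (- x)
  SignedSum-neg [] = []
  SignedSum-neg (cons {h′ = h′} {y = y} {x = x} l s refl refl) =
    cons (- l) (SignedSum-neg s) (cong (ℕ._+ h′) (sym (ℤₚ.∣-i∣≡∣i∣ l))) (neg-distrib l y x)
    where
    neg-distrib : ∀ l y x → - (l * y + x) ≡ (- l) * y + - x
    neg-distrib = ℤSolver.solve-∀

  SignedSum-zero : ∀ ys → SignedSum 0 ys (+ 0)
  SignedSum-zero []       = []
  SignedSum-zero (y ∷ ys) = cons (+ 0) (SignedSum-zero ys) refl (sym (ℤₚ.+-identityˡ (+ 0 * y)))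

  SignedSum-skip : ∀ {h ys x} y → SignedSum h ys x → SignedSum h (y ∷ ys) x
  SignedSum-skip {x = x} y s = cons (+ 0) s refl (sym (ℤₚ.+-identityˡ x))

  SignedSum-∣∣≤ : ∀ {h ys x} M → All (λ y → ∣ y ∣ ℕ.≤ M) ys → SignedSum h ys x → ∣ x ∣ ℕ.≤ h ℕ.* M
  SignedSum-∣∣≤ M [] [] = z≤n
  SignedSum-∣∣≤ M (∣y∣≤M ∷ ys≤M) (cons {h′ = h′} {y = y} {x = x} l s refl refl) = begin
    ∣ l * y + x ∣           ≤⟨ ℤₚ.∣i+j∣≤∣i∣+∣j∣ (l * y) x ⟩
    ∣ l * y ∣ ℕ.+ ∣ x ∣     ≡⟨ cong (ℕ._+ ∣ x ∣) (ℤₚ.∣i*j∣≡∣i∣*∣j∣ l y) ⟩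
    ∣ l ∣ ℕ.* ∣ y ∣ ℕ.+ ∣ x ∣ ≤⟨ ℕₚ.+-mono-≤ (ℕₚ.*-monoʳ-≤ ∣ l ∣ ∣y∣≤M) (SignedSum-∣∣≤ M ys≤M s) ⟩
    ∣ l ∣ ℕ.* M ℕ.+ h′ ℕ.* M ≡⟨ ℕₚ.*-distribʳ-+ M ∣ l ∣ h′ ⟨
    (∣ l ∣ ℕ.+ h′) ℕ.* M    ∎
    where open ℕₚ.≤-Reasoning

  Odd : ℤ → Set
  Odd y = ∃ λ r → y ≡ r + r + 1

  l+∣l∣-even : ∀ l → ∃ λ t → l + + ∣ l ∣ ≡ t + t
  l+∣l∣-even (+ n)    = + n , refl
  l+∣l∣-even -[1+ n ] = + 0 , ℤₚ.+-inverseˡ (+ suc n)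

  SignedSum-parity : ∀ {h ys x} → All Odd ys → SignedSum h ys x → ∃ λ q → x + + h ≡ q + q
  SignedSum-parity [] [] = + 0 , refl
  SignedSum-parity ((r , refl) ∷ odd) (cons {h′ = h′} {x = x} l s refl refl)
    with q , x+h′≡q+q ← SignedSum-parity odd s
    with t , l+∣l∣≡t+t ← l+∣l∣-even l
    = l * r + t + q , (begin
      l * (r + r + 1) + x + (+ ∣ l ∣ + + h′)          ≡⟨ regroup l r x (+ ∣ l ∣) (+ h′) ⟩
      (l * r + l * r) + (l + + ∣ l ∣) + (x + + h′)    ≡⟨ cong₂ (λ u v → (l * r + l * r) + u + v) l+∣l∣≡t+t x+h′≡q+q ⟩
      (l * r + l * r) + (t + t) + (q + q)             ≡⟨ halve l r t q ⟩
      (l * r + t + q) + (l * r + t + q)               ∎)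
    where
    open ≡-Reasoning
    regroup : ∀ l r x a h → l * (r + r + 1) + x + (a + h) ≡ (l * r + l * r) + (l + a) + (x + h)
    regroup = ℤSolver.solve-∀
    halve : ∀ l r t q → (l * r + l * r) + (t + t) + (q + q) ≡ (l * r + t + q) + (l * r + t + q)
    halve = ℤSolver.solve-∀

  toSignedSumset : ∀ {k h x} (a : Fin k → ℤ) → SignedSum h (tabulate a) x → SignedSumset h a x
  toSignedSumset {zero} a [] = (λ ()) , refl , refl
  toSignedSumset {suc k} a (cons l s refl refl) with toSignedSumset (λ i → a (suc i)) s
  ... | λs , refl , refl = (λ { zero → l ; (suc i) → λs i }) , refl , refl

  fromSignedSumset : ∀ {k h x} (a : Fin k → ℤ) → SignedSumset h a x → SignedSum h (tabulate a) x
  fromSignedSumset {zero} a (λs , refl , refl) = []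
  fromSignedSumset {suc k} a (λs , refl , refl) =
    cons (λs zero) (fromSignedSumset (λ i → a (suc i)) ((λ i → λs (suc i)) , refl , refl)) refl refl

  coefficients : ℕ → List ℤ
  coefficients zero    = [ + 0 ]
  coefficients (suc h) = + suc h ∷ -[1+ h ] ∷ coefficients h

  ∈-coefficients⁻ : ∀ {h l} → l ∈ coefficients h → ∣ l ∣ ℕ.≤ h
  ∈-coefficients⁻ {zero}  (here refl)         = z≤n
  ∈-coefficients⁻ {suc h} (here refl)         = ℕₚ.≤-refl
  ∈-coefficients⁻ {suc h} (there (here refl)) = ℕₚ.≤-refl
  ∈-coefficients⁻ {suc h} (there (there l∈))  = ℕₚ.m≤n⇒m≤1+n (∈-coefficients⁻ l∈)

  ∈-coefficients⁺ : ∀ h l → ∣ l ∣ ℕ.≤ h → l ∈ coefficients h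
  ∈-coefficients⁺ zero (+ zero) z≤n = here refl
  ∈-coefficients⁺ (suc h) l ∣l∣≤ with ∣ l ∣ ℕ.≟ suc h
  ∈-coefficients⁺ (suc h) (+ .(suc h)) _ | yes refl = here refl
  ∈-coefficients⁺ (suc h) -[1+ .h ]    _ | yes refl = there (here refl)
  ... | no ∣l∣≢ = there (there (∈-coefficients⁺ h l (ℕₚ.≤-pred (ℕₚ.≤∧≢⇒< ∣l∣≤ ∣l∣≢))))

  signedSums : ℕ → List ℤ → List ℤ
  signedSums h       (y ∷ ys) =
    concatMap (λ l → map (λ x → l * y + x) (signedSums (h ℕ.∸ ∣ l ∣) ys)) (coefficients h)
  signedSums zero    []       = [ + 0 ]
  signedSums (suc h) []       = []

  ∈-signedSums⁻ : ∀ h ys {z} → z ∈ signedSums h ys → SignedSum h ys z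
  ∈-signedSums⁻ zero [] (here refl) = []
  ∈-signedSums⁻ h (y ∷ ys) z∈
    with l , l∈ , z∈′ ← find (∈-concatMap⁻ (λ l → map (λ x → l * y + x) (signedSums (h ℕ.∸ ∣ l ∣) ys))
                                           {xs = coefficients h} z∈)
    with x , x∈ , refl ← ∈-map⁻ (λ x → l * y + x) z∈′
    = cons l (∈-signedSums⁻ _ ys x∈) (sym (ℕₚ.m+[n∸m]≡n (∈-coefficients⁻ l∈))) refl

  ∈-signedSums⁺ : ∀ {h ys z} → SignedSum h ys z → z ∈ signedSums h ys
  ∈-signedSums⁺ [] = here refl
  ∈-signedSums⁺ {ys = y ∷ ys} (cons {h′ = h′} {x = x} l s refl refl) =
    ∈-concatMap⁺ (λ l′ → map (λ x → l′ * y + x) (signedSums ((∣ l ∣ ℕ.+ h′) ℕ.∸ ∣ l′ ∣) ys))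
      (lose (∈-coefficients⁺ _ l (ℕₚ.m≤m+n ∣ l ∣ h′))
        (∈-map⁺ (λ x → l * y + x) (subst (λ h → x ∈ signedSums h ys) (sym (ℕₚ.m+n∸m≡n ∣ l ∣ h′)) (∈-signedSums⁺ s))))

  lookup-injective : ∀ {A : Set} {xs : List A} → Unique xs → Injective _≡_ _≡_ (lookup xs)
  lookup-injective (_   ∷ _)  {zero}  {zero}  _ = refl
  lookup-injective (x≢ ∷ _)   {zero}  {suc j} e = ⊥-elim (All.lookup x≢ (∈-lookup j) e)
  lookup-injective (x≢ ∷ _)   {suc i} {zero}  e = ⊥-elim (All.lookup x≢ (∈-lookup i) (sym e))
  lookup-injective (_  ∷ xs!) {suc i} {suc j} e = cong suc (lookup-injective xs! e)

  HasCard-unique : ∀ {S : ℤ → Set} {xs} → Unique xs → (∀ {x} → S x → x ∈ xs) → (∀ {x} → x ∈ xs → S x) →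
                   HasCard S (length xs)
  HasCard-unique {xs = xs} xs! ⊆xs xs⊆ =
    lookup xs , lookup-injective xs! , (λ i → xs⊆ (∈-lookup i)) , λ x s → index (⊆xs s) , sym (lookup-index (⊆xs s))

  SignedSumset-finite : ∀ {k} h (a : Fin k → ℤ) → ∃ λ n → HasCard (SignedSumset h a) n
  SignedSumset-finite h a = _ , HasCard-unique (deduplicate-! ℤ._≟_ (signedSums h (tabulate a)))
    (λ s → ∈-deduplicate⁺ ℤ._≟_ (∈-signedSums⁺ (fromSignedSumset a s)))
    (λ x∈ → toSignedSumset a (∈-signedSums⁻ h _ (∈-deduplicate⁻ ℤ._≟_ _ x∈)))

  Unique⇒length≤card : ∀ {S : ℤ → Set} {n xs} → Unique xs → All S xs → HasCard S n → length xs ℕ.≤ n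
  Unique⇒length≤card {xs = xs} xs! xs⊆ (f , f-inj , _ , onto) = Finₚ.injective⇒≤ {f = position} position-inj
    where
    position : Fin (length xs) → Fin _
    position i = proj₁ (onto (lookup xs i) (All.lookup xs⊆ (∈-lookup i)))
    position-inj : Injective _≡_ _≡_ position
    position-inj {i} {j} e = lookup-injective xs!
      (trans (sym (proj₂ (onto _ _))) (trans (cong f e) (proj₂ (onto _ _))))

  cover⇒card≤ : ∀ {S : ℤ → Set} {n m} → HasCard S n → (e : Fin m → ℤ) → (∀ {x} → S x → ∃ λ j → e j ≡ x) →
                n ℕ.≤ m
  cover⇒card≤ (f , f-inj , f∈ , _) e cover = Finₚ.injective⇒≤ {f = preimage} preimage-inj
    where
    preimage : Fin _ → Fin _
    preimage i = proj₁ (cover (f∈ i))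
    preimage-inj : Injective _≡_ _≡_ preimage
    preimage-inj {i} {j} e≡ = f-inj (trans (sym (proj₂ (cover (f∈ i)))) (trans (cong e e≡) (proj₂ (cover (f∈ j)))))

  0<-gap : ∀ {x y} → x < y → 0 < y - x
  0<-gap {x} {y} x<y = subst (_< y - x) (ℤₚ.+-inverseʳ x) (ℤₚ.+-monoˡ-< (- x) x<y)

  <-by : ∀ {x y d} → 0 < d → y ≡ x + d → x < y
  <-by {x} {d = d} 0<d refl = subst (_< x + d) (ℤₚ.+-identityʳ x) (ℤₚ.+-monoʳ-< x 0<d)

  neg≢pos : ∀ {x y} → 0 < x → 0 < y → - x ≢ y
  neg≢pos {x} 0<x 0<y refl = ℤₚ.<-asym 0<y (ℤₚ.neg-mono-< 0<x)

  ∣∣-mono-≤ : ∀ {x y} → 0 ≤ x → x ≤ y → ∣ x ∣ ℕ.≤ ∣ y ∣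
  ∣∣-mono-≤ (+≤+ _) (+≤+ m≤n) = m≤n

  ∣∣≤⇒bounds : ∀ {x n} → ∣ x ∣ ℕ.≤ n → - + n ≤ x × x ≤ + n
  ∣∣≤⇒bounds {+ m}      m≤n  = ℤₚ.≤-trans (ℤₚ.neg-mono-≤ (+≤+ z≤n)) (+≤+ z≤n) , +≤+ m≤n
  ∣∣≤⇒bounds { -[1+ m ]} m<n = ℤₚ.neg-mono-≤ (+≤+ m<n) , -≤+

  +<⇒<∣∣ : ∀ {n y} → + n < y → n ℕ.< ∣ y ∣
  +<⇒<∣∣ (+<+ n<m) = n<m

  -- antidiagonal B p q rest = B p q ++ B (p ∸ 1) (q + 1) ++ ⋯ ++ B 0 (p + q) ++ rest, with the first block
  -- split off definitionally so that the head of a concrete chain computes.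
  module _ {A : Set} {r : ℕ} (B : ℕ → ℕ → Vec A (suc r)) where

    antidiagonal antidiagonalTail : ℕ → ℕ → List A → List A
    antidiagonal p q rest = toList (B p q) ++ antidiagonalTail p q rest
    antidiagonalTail zero    q rest = rest
    antidiagonalTail (suc p) q rest = antidiagonal p (suc q) rest

    length-antidiagonal : ∀ p q rest → length (antidiagonal p q rest) ≡ suc r ℕ.* suc p ℕ.+ length rest
    length-antidiagonalTail : ∀ p q rest → length (antidiagonalTail p q rest) ≡ suc r ℕ.* p ℕ.+ length rest
    length-antidiagonal p q rest = begin
      length (toList (B p q) ++ antidiagonalTail p q rest)           ≡⟨ Listₚ.length-++ (toList (B p q)) ⟩
      length (toList (B p q)) ℕ.+ length (antidiagonalTail p q rest)
        ≡⟨ cong₂ ℕ._+_ (Vecₚ.length-toList (B p q)) (length-antidiagonalTail p q rest) ⟩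
      suc r ℕ.+ (suc r ℕ.* p ℕ.+ length rest)                         ≡⟨ ℕₚ.+-assoc (suc r) _ _ ⟨
      suc r ℕ.+ suc r ℕ.* p ℕ.+ length rest                           ≡⟨ cong (ℕ._+ length rest) (ℕₚ.*-suc (suc r) p) ⟨
      suc r ℕ.* suc p ℕ.+ length rest                                 ∎
      where open ≡-Reasoning
    length-antidiagonalTail zero    q rest = cong (ℕ._+ length rest) (sym (ℕₚ.*-zeroʳ (suc r)))
    length-antidiagonalTail (suc p) q rest = length-antidiagonal p (suc q) rest

    All-antidiagonal : ∀ {P : A → Set} {K} → (∀ {p q} → p ℕ.+ q ≡ K → All P (toList (B p q))) →
                       ∀ p q {rest} → p ℕ.+ q ≡ K → All P rest → All P (antidiagonal p q rest)
    All-antidiagonal PB zero    q e Prest = Allₚ.++⁺ (PB e) Prest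
    All-antidiagonal PB (suc p) q e Prest =
      Allₚ.++⁺ (PB e) (All-antidiagonal PB p (suc q) (trans (ℕₚ.+-suc p q) e) Prest)

    Linked-antidiagonal : ∀ {R : A → A → Set} {K} → (∀ p q → Linked R (toList (B p q))) →
      (∀ p q → Connected R (last (toList (B (suc p) q))) (head (toList (B p (suc q))))) →
      ∀ p q {rest} → p ℕ.+ q ≡ K → Connected R (last (toList (B 0 K))) (head rest) → Linked R rest →
      Linked R (antidiagonal p q rest)
    Linked-antidiagonal RB RB′ zero q refl Rrest₀ Rrest = Linkedₚ.++⁺ (RB 0 q) Rrest₀ Rrest
    Linked-antidiagonal {R} RB RB′ (suc p) q e Rrest₀ Rrest = Linkedₚ.++⁺ (RB (suc p) q)
      (subst (Connected R _) (sym (head-toList-++ (B p (suc q)))) (RB′ p q))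
      (Linked-antidiagonal RB RB′ p (suc q) (trans (ℕₚ.+-suc p q) e) Rrest₀ Rrest)
      where
      head-toList-++ : ∀ {n ys} (v : Vec A (suc n)) → head (toList v ++ ys) ≡ head (toList v)
      head-toList-++ (x ∷ v) = refl

  record DistinctSignedSums (h : ℕ) (ys : List ℤ) (n : ℕ) : Set where
    constructor distinct
    field
      sums        : List ℤ
      sums-unique : Unique sums
      sums-signed : All (SignedSum h ys) sums
      sums-many   : n ℕ.≤ length sums

  DistinctSignedSums-≤ : ∀ {h ys m n} → m ℕ.≤ n → DistinctSignedSums h ys n → DistinctSignedSums h ys m
  DistinctSignedSums-≤ m≤n (distinct xs xs! xs-signed n≤) = distinct xs xs! xs-signed (ℕₚ.≤-trans m≤n n≤)

  DistinctSignedSums-skip : ∀ {h ys n} y → DistinctSignedSums h ys n → DistinctSignedSums h (y ∷ ys) n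
  DistinctSignedSums-skip y (distinct xs xs! xs-signed n≤) = distinct xs xs! (All.map (SignedSum-skip y) xs-signed) n≤

  DistinctSignedSums-++ : ∀ {h ys m n} B (X : DistinctSignedSums h ys m) (Y : DistinctSignedSums h ys n) →
    All (λ x → B ℕ.< ∣ x ∣) (DistinctSignedSums.sums X) → All (λ y → ∣ y ∣ ℕ.≤ B) (DistinctSignedSums.sums Y) →
    DistinctSignedSums h ys (m ℕ.+ n)
  DistinctSignedSums-++ B (distinct xs xs! xs-signed m≤) (distinct ys ys! ys-signed n≤) xs>B ys≤B =
    distinct (xs ++ ys)
      (AllPairsₚ.++⁺ xs! ys! (All.map (λ B<∣x∣ → All.map (separated B<∣x∣) ys≤B) xs>B))
      (Allₚ.++⁺ xs-signed ys-signed)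
      (subst (_ ℕ.≤_) (sym (Listₚ.length-++ xs)) (ℕₚ.+-mono-≤ m≤ n≤))
    where
    separated : ∀ {x y} → B ℕ.< ∣ x ∣ → ∣ y ∣ ℕ.≤ B → x ≢ y
    separated B<∣x∣ ∣y∣≤B refl = ℕₚ.<⇒≱ B<∣x∣ ∣y∣≤B

  DistinctSignedSums⇒≤card : ∀ {h k ys n m} {a : Fin k → ℤ} → DistinctSignedSums h ys n → ys ↭ tabulate a →
                             HasCard (SignedSumset h a) m → n ℕ.≤ m
  DistinctSignedSums⇒≤card {a = a} (distinct xs xs! xs-signed n≤) ys↭a card =
    ℕₚ.≤-trans n≤ (Unique⇒length≤card xs! (All.map (toSignedSumset a ∘ SignedSum-resp-↭ ys↭a) xs-signed) card)

  increasing⇒Unique : ∀ {xs} → Linked _<_ xs → Unique xs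
  increasing⇒Unique xs↗ = AllPairs.map ℤₚ.<⇒≢ (Linkedₚ.Linked⇒AllPairs ℤₚ.<-trans xs↗)

  symmetricSums : ∀ {h ys xs} → Linked _<_ xs → All (0 <_) xs → All (SignedSum h ys) xs →
                  DistinctSignedSums h ys (length xs ℕ.+ length xs)
  symmetricSums {xs = xs} xs↗ xs>0 xs-signed = distinct (map -_ xs ++ xs)
    (AllPairsₚ.++⁺ (AllPairsₚ.map⁺ (AllPairs.map (λ x≢y → x≢y ∘ ℤₚ.neg-injective) xs!)) xs!
      (Allₚ.map⁺ (All.map (λ 0<x → All.map (neg≢pos 0<x) xs>0) xs>0)))
    (Allₚ.++⁺ (Allₚ.map⁺ (All.map SignedSum-neg xs-signed)) xs-signed)
    (ℕₚ.≤-reflexive (sym (trans (Listₚ.length-++ (map -_ xs)) (cong (ℕ._+ length xs) (Listₚ.length-map -_ xs)))))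
    where
    xs! : Unique xs
    xs! = increasing⇒Unique xs↗

  minSize : ℕ → ℕ → ℕ
  minSize h k = 2 ℕ.* h ℕ.* k ℕ.∸ h ℕ.+ 1

  minSize-suc : ∀ h k → minSize h (suc k) ≡ 2 ℕ.* h ℕ.* k ℕ.+ h ℕ.+ 1
  minSize-suc h k = cong (ℕ._+ 1) (trans (cong (ℕ._∸ h) (expand h k)) (ℕₚ.m+n∸n≡m (2 ℕ.* h ℕ.* k ℕ.+ h) h))
    where
    expand : ∀ h k → 2 ℕ.* h ℕ.* (1 ℕ.+ k) ≡ 2 ℕ.* h ℕ.* k ℕ.+ h ℕ.+ h
    expand = ℕSolver.solve-∀

  minSize-3 : ∀ h → minSize h 3 ≡ 5 ℕ.* h ℕ.+ 1
  minSize-3 h = trans (minSize-suc h 2) (five h)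
    where
    five : ∀ h → 2 ℕ.* h ℕ.* 2 ℕ.+ h ℕ.+ 1 ≡ 5 ℕ.* h ℕ.+ 1
    five = ℕSolver.solve-∀

  minSize-step : ∀ h k → minSize h (suc (suc k)) ≡ (h ℕ.+ h) ℕ.+ minSize h (suc k)
  minSize-step h k = trans (minSize-suc h (suc k)) (trans (regroup h k) (cong ((h ℕ.+ h) ℕ.+_) (sym (minSize-suc h k))))
    where
    regroup : ∀ h k → 2 ℕ.* h ℕ.* (1 ℕ.+ k) ℕ.+ h ℕ.+ 1 ≡ (h ℕ.+ h) ℕ.+ (2 ℕ.* h ℕ.* k ℕ.+ h ℕ.+ 1)
    regroup = ℕSolver.solve-∀

  module ThreeElements (a b c : ℤ) where

    V : ℤ → ℤ → ℤ → ℤ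
    V u v w = w * c + (v * b + (u * a + 0))

    SignedSum-V : ∀ {h i j k} u v w → ∣ u ∣ ≡ i → ∣ v ∣ ≡ j → ∣ w ∣ ≡ k → i ℕ.+ j ℕ.+ k ≡ h →
                  SignedSum h (c ∷ b ∷ a ∷ []) (V u v w)
    SignedSum-V u v w refl refl refl refl =
      cons w (cons v (cons u [] refl refl) refl refl) (reorder (∣ u ∣) (∣ v ∣) (∣ w ∣)) refl
      where
      reorder : ∀ i j k → i ℕ.+ j ℕ.+ k ≡ k ℕ.+ (j ℕ.+ (i ℕ.+ 0))
      reorder = ℕSolver.solve-∀

    V-< : ∀ u v w u′ v′ w′ {d} → 0 < d → (u′ - u) * a + ((v′ - v) * b + (w′ - w) * c) ≡ d → V u v w < V u′ v′ w′
    V-< u v w u′ v′ w′ 0<d Δ≡d = <-by 0<d (trans (linear a b c u v w u′ v′ w′) (cong (λ t → V u v w + t) Δ≡d))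
      where
      linear : ∀ a b c u v w u′ v′ w′ → w′ * c + (v′ * b + (u′ * a + 0)) ≡
               (w * c + (v * b + (u * a + 0))) + ((u′ - u) * a + ((v′ - v) * b + (w′ - w) * c))
      linear = ℤSolver.solve-∀

    V-pos : ∀ n → 0 < a → 0 < V (+ suc n) 0 0
    V-pos n 0<a = subst (0 <_) (sym (only-a (+ suc n) a b c))
      (subst (_< + suc n * a) (ℤₚ.*-zeroʳ (+ suc n)) (ℤₚ.*-monoˡ-<-pos (+ suc n) 0<a))
      where
      only-a : ∀ n a b c → 0 * c + (0 * b + (n * a + 0)) ≡ n * a
      only-a = ℤSolver.solve-∀

  module GapsIncreasing (a b c : ℤ) (h₂ : ℕ) (0<b-a : 0 < b - a) (0<c-b : 0 < c - b) (gaps-increase : 0 < (c - b) - (b - a)) where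

    open ThreeElements a b c

    h : ℕ
    h = suc (suc h₂)

    line : ℕ → ℕ → Vec ℤ 1
    line p q = V (+ p) (+ q) 0 ∷ []

    zigzag : ℕ → ℕ → Vec ℤ 2
    zigzag p q = V 1 (+ p) (+ q) ∷ V 0 (+ suc p) (+ q) ∷ []

    chain : List ℤ
    chain = antidiagonal line h 0 (antidiagonal zigzag h₂ 1 [ V 0 0 (+ h) ])

    line↗ : ∀ p q → V (+ suc p) (+ q) 0 < V (+ p) (+ suc q) 0
    line↗ p q = V-< (+ suc p) (+ q) 0 (+ p) (+ suc q) 0 0<b-a (Δ (+ p) (+ q) a b c)
      where Δ : ∀ P Q a b c → (P - (1 + P)) * a + (((1 + Q) - Q) * b + (0 - 0) * c) ≡ b - a
            Δ = ℤSolver.solve-∀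
    line→zigzag : V 0 (+ h) 0 < V 1 (+ h₂) 1
    line→zigzag = V-< 0 (+ h) 0 1 (+ h₂) 1 gaps-increase (Δ (+ h₂) a b c)
      where Δ : ∀ H a b c → (1 - 0) * a + ((H - (2 + H)) * b + (1 - 0) * c) ≡ (c - b) - (b - a)
            Δ = ℤSolver.solve-∀
    zig : ∀ p q → V 1 (+ p) (+ q) < V 0 (+ suc p) (+ q)
    zig p q = V-< 1 (+ p) (+ q) 0 (+ suc p) (+ q) 0<b-a (Δ (+ p) (+ q) a b c)
      where Δ : ∀ P Q a b c → (0 - 1) * a + (((1 + P) - P) * b + (Q - Q) * c) ≡ b - a
            Δ = ℤSolver.solve-∀
    zag : ∀ p q → V 0 (+ suc (suc p)) (+ q) < V 1 (+ p) (+ suc q)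
    zag p q = V-< 0 (+ suc (suc p)) (+ q) 1 (+ p) (+ suc q) gaps-increase (Δ (+ p) (+ q) a b c)
      where Δ : ∀ P Q a b c → (1 - 0) * a + ((P - (2 + P)) * b + ((1 + Q) - Q) * c) ≡ (c - b) - (b - a)
            Δ = ℤSolver.solve-∀
    zigzag→top : V 0 1 (+ suc h₂) < V 0 0 (+ h)
    zigzag→top = V-< 0 1 (+ suc h₂) 0 0 (+ h) 0<c-b (Δ (+ h₂) a b c)
      where Δ : ∀ H a b c → (0 - 0) * a + ((0 - 1) * b + ((2 + H) - (1 + H)) * c) ≡ c - b
            Δ = ℤSolver.solve-∀

    chain↗ : Linked _<_ chain
    chain↗ = Linked-antidiagonal line (λ _ _ → [-]) (λ p q → just (line↗ p q)) h 0 (ℕₚ.+-identityʳ h) (just line→zigzag)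
      (Linked-antidiagonal zigzag (λ p q → zig p q ∷ [-]) (λ p q → just (zag p q)) h₂ 1 (ℕₚ.+-comm h₂ 1) (just zigzag→top) [-])

    chain-signed : All (SignedSum h (c ∷ b ∷ a ∷ [])) chain
    chain-signed =
      All-antidiagonal line (λ {p} {q} e → SignedSum-V (+ p) (+ q) 0 refl refl refl (trans (ℕₚ.+-identityʳ _) e) ∷ [])
        h 0 (ℕₚ.+-identityʳ h)
      (All-antidiagonal zigzag (λ {p} {q} e → SignedSum-V 1 (+ p) (+ q) refl refl refl (cong suc e)
                                            ∷ SignedSum-V 0 (+ suc p) (+ q) refl refl refl (cong suc e) ∷ [])
        h₂ 1 (ℕₚ.+-comm h₂ 1)
      (SignedSum-V 0 0 (+ h) refl refl refl refl ∷ []))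

    length-chain : length chain ≡ 3 ℕ.* h
    length-chain = trans (length-antidiagonal line h 0 _)
      (trans (cong (1 ℕ.* suc h ℕ.+_) (length-antidiagonal zigzag h₂ 1 _)) (count h₂))
      where count : ∀ x → 1 ℕ.* (3 ℕ.+ x) ℕ.+ (2 ℕ.* (1 ℕ.+ x) ℕ.+ 1) ≡ 3 ℕ.* (2 ℕ.+ x)
            count = ℕSolver.solve-∀

  module GapsDecreasing (a b c : ℤ) (h₂ : ℕ) (0<b-a : 0 < b - a) (0<c-b : 0 < c - b) (gaps-decrease : 0 < (b - a) - (c - b)) where

    open ThreeElements a b c

    h : ℕ
    h = suc (suc h₂)

    kink : ℕ → ℕ → Vec ℤ 2
    kink p q = V (+ suc p) (+ q) 1 ∷ V (+ p) (+ suc (suc q)) 0 ∷ []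

    column : ℕ → ℕ → Vec ℤ 1
    column p q = V 0 (+ p) (+ q) ∷ []

    chain : List ℤ
    chain = V (+ h) 0 0 ∷ V (+ suc h₂) 1 0 ∷ antidiagonal kink h₂ 0 (antidiagonal column (suc h₂) 1 [])

    start : V (+ h) 0 0 < V (+ suc h₂) 1 0
    start = V-< (+ h) 0 0 (+ suc h₂) 1 0 0<b-a (Δ (+ h₂) a b c)
      where Δ : ∀ H a b c → ((1 + H) - (2 + H)) * a + ((1 - 0) * b + (0 - 0) * c) ≡ b - a
            Δ = ℤSolver.solve-∀
    start→kink : V (+ suc h₂) 1 0 < V (+ suc h₂) 0 1
    start→kink = V-< (+ suc h₂) 1 0 (+ suc h₂) 0 1 0<c-b (Δ (+ h₂) a b c)
      where Δ : ∀ H a b c → ((1 + H) - (1 + H)) * a + ((0 - 1) * b + (1 - 0) * c) ≡ c - b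
            Δ = ℤSolver.solve-∀
    kink↗ : ∀ p q → V (+ suc p) (+ q) 1 < V (+ p) (+ suc (suc q)) 0
    kink↗ p q = V-< (+ suc p) (+ q) 1 (+ p) (+ suc (suc q)) 0 gaps-decrease (Δ (+ p) (+ q) a b c)
      where Δ : ∀ P Q a b c → (P - (1 + P)) * a + (((2 + Q) - Q) * b + (0 - 1) * c) ≡ (b - a) - (c - b)
            Δ = ℤSolver.solve-∀
    kink→kink : ∀ p q → V (+ suc p) (+ suc (suc q)) 0 < V (+ suc p) (+ suc q) 1
    kink→kink p q = V-< (+ suc p) (+ suc (suc q)) 0 (+ suc p) (+ suc q) 1 0<c-b (Δ (+ p) (+ q) a b c)
      where Δ : ∀ P Q a b c → ((1 + P) - (1 + P)) * a + (((1 + Q) - (2 + Q)) * b + (1 - 0) * c) ≡ c - b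
            Δ = ℤSolver.solve-∀
    kink→column : V 0 (+ h) 0 < V 0 (+ suc h₂) 1
    kink→column = V-< 0 (+ h) 0 0 (+ suc h₂) 1 0<c-b (Δ (+ h₂) a b c)
      where Δ : ∀ H a b c → (0 - 0) * a + (((1 + H) - (2 + H)) * b + (1 - 0) * c) ≡ c - b
            Δ = ℤSolver.solve-∀
    column↗ : ∀ p q → V 0 (+ suc p) (+ q) < V 0 (+ p) (+ suc q)
    column↗ p q = V-< 0 (+ suc p) (+ q) 0 (+ p) (+ suc q) 0<c-b (Δ (+ p) (+ q) a b c)
      where Δ : ∀ P Q a b c → (0 - 0) * a + ((P - (1 + P)) * b + ((1 + Q) - Q) * c) ≡ c - b
            Δ = ℤSolver.solve-∀

    chain↗ : Linked _<_ chain
    chain↗ = start ∷ start→kink ∷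
      Linked-antidiagonal kink (λ p q → kink↗ p q ∷ [-]) (λ p q → just (kink→kink p q)) h₂ 0 (ℕₚ.+-identityʳ h₂) (just kink→column)
        (Linked-antidiagonal column (λ _ _ → [-]) (λ p q → just (column↗ p q)) (suc h₂) 1 (ℕₚ.+-comm (suc h₂) 1) just-nothing [])

    chain-signed : All (SignedSum h (c ∷ b ∷ a ∷ [])) chain
    chain-signed =
      SignedSum-V (+ h) 0 0 refl refl refl (trans (ℕₚ.+-identityʳ _) (ℕₚ.+-identityʳ h)) ∷
      SignedSum-V (+ suc h₂) 1 0 refl refl refl (trans (ℕₚ.+-identityʳ _) (ℕₚ.+-comm (suc h₂) 1)) ∷
      All-antidiagonal kink (λ {p} {q} e → SignedSum-V (+ suc p) (+ q) 1 refl refl refl (trans (weight₁ p q) (cong (2 ℕ.+_) e))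
                                         ∷ SignedSum-V (+ p) (+ suc (suc q)) 0 refl refl refl (trans (weight₂ p q) (cong (2 ℕ.+_) e)) ∷ [])
        h₂ 0 (ℕₚ.+-identityʳ h₂)
      (All-antidiagonal column (λ {p} {q} e → SignedSum-V 0 (+ p) (+ q) refl refl refl e ∷ []) (suc h₂) 1 (ℕₚ.+-comm (suc h₂) 1) [])
      where
      weight₁ : ∀ p q → suc p ℕ.+ q ℕ.+ 1 ≡ 2 ℕ.+ (p ℕ.+ q)
      weight₁ = ℕSolver.solve-∀
      weight₂ : ∀ p q → p ℕ.+ suc (suc q) ℕ.+ 0 ≡ 2 ℕ.+ (p ℕ.+ q)
      weight₂ = ℕSolver.solve-∀

    length-chain : length chain ≡ 3 ℕ.* h
    length-chain = trans (cong (2 ℕ.+_) (trans (length-antidiagonal kink h₂ 0 _)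
      (cong (2 ℕ.* suc h₂ ℕ.+_) (length-antidiagonal column (suc h₂) 1 [])))) (count h₂)
      where count : ∀ x → 2 ℕ.+ (2 ℕ.* (1 ℕ.+ x) ℕ.+ (1 ℕ.* (2 ℕ.+ x) ℕ.+ 0)) ≡ 3 ℕ.* (2 ℕ.+ x)
            count = ℕSolver.solve-∀

  module GapsEqual (a b : ℤ) (h₃ : ℕ) (0<a : 0 < a) (0<b-a : 0 < b - a) where

    c : ℤ
    c = b + (b - a)

    open ThreeElements a b c

    h : ℕ
    h = suc (suc (suc h₃))

    0<2a : 0 < a + a
    0<2a = ℤₚ.+-mono-< 0<a 0<a

    descent : ℕ → ℕ → Vec ℤ 1
    descent p q = V 0 (- + q) (- + p) ∷ []

    retreat : ℕ → ℕ → Vec ℤ 1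
    retreat p q = V (- + q) (- + p) 0 ∷ []

    climb : ℕ → ℕ → Vec ℤ 3
    climb p q = V (- + p) (- 2) (+ q) ∷ V (- + suc p) (- 1) (+ q) ∷ V (- + suc (suc p)) 0 (+ q) ∷ []

    summit : List ℤ
    summit = V (- 1) 2 (+ h₃) ∷ V 0 (- 1) (+ suc (suc h₃)) ∷ V (- 1) 0 (+ suc (suc h₃))
           ∷ V 1 0 (+ suc (suc h₃)) ∷ V 0 1 (+ suc (suc h₃)) ∷ V 0 0 (+ h) ∷ []

    chain : List ℤ
    chain = antidiagonal descent h 0 (antidiagonal retreat (suc (suc h₃)) 1 (antidiagonal climb h₃ 1 summit))

    descent↗ : ∀ p q → V 0 (- + q) (- + suc p) < V 0 (- + suc q) (- + p)
    descent↗ p q = V-< 0 (- + q) (- + suc p) 0 (- + suc q) (- + p) 0<b-a (Δ (+ p) (+ q) a b)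
      where Δ : ∀ P Q a b → (0 - 0) * a + (((- (1 + Q)) - (- Q)) * b + ((- P) - (- (1 + P))) * (b + (b - a))) ≡ b - a
            Δ = ℤSolver.solve-∀
    descent→retreat : V 0 (- + h) 0 < V (- 1) (- + suc (suc h₃)) 0
    descent→retreat = V-< 0 (- + h) 0 (- 1) (- + suc (suc h₃)) 0 0<b-a (Δ (+ h₃) a b)
      where Δ : ∀ H a b → ((- 1) - 0) * a + (((- (2 + H)) - (- (3 + H))) * b + (0 - 0) * (b + (b - a))) ≡ b - a
            Δ = ℤSolver.solve-∀
    retreat↗ : ∀ p q → V (- + q) (- + suc p) 0 < V (- + suc q) (- + p) 0
    retreat↗ p q = V-< (- + q) (- + suc p) 0 (- + suc q) (- + p) 0 0<b-a (Δ (+ p) (+ q) a b)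
      where Δ : ∀ P Q a b → ((- (1 + Q)) - (- Q)) * a + (((- P) - (- (1 + P))) * b + (0 - 0) * (b + (b - a))) ≡ b - a
            Δ = ℤSolver.solve-∀
    retreat→climb : V (- + h) 0 0 < V (- + h₃) (- 2) 1
    retreat→climb = V-< (- + h) 0 0 (- + h₃) (- 2) 1 0<2a (Δ (+ h₃) a b)
      where Δ : ∀ H a b → ((- H) - (- (3 + H))) * a + (((- 2) - 0) * b + (1 - 0) * (b + (b - a))) ≡ a + a
            Δ = ℤSolver.solve-∀
    climb↗₁ : ∀ p q → V (- + p) (- 2) (+ q) < V (- + suc p) (- 1) (+ q)
    climb↗₁ p q = V-< (- + p) (- 2) (+ q) (- + suc p) (- 1) (+ q) 0<b-a (Δ (+ p) (+ q) a b)
      where Δ : ∀ P Q a b → ((- (1 + P)) - (- P)) * a + (((- 1) - (- 2)) * b + (Q - Q) * (b + (b - a))) ≡ b - a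
            Δ = ℤSolver.solve-∀
    climb↗₂ : ∀ p q → V (- + suc p) (- 1) (+ q) < V (- + suc (suc p)) 0 (+ q)
    climb↗₂ p q = V-< (- + suc p) (- 1) (+ q) (- + suc (suc p)) 0 (+ q) 0<b-a (Δ (+ p) (+ q) a b)
      where Δ : ∀ P Q a b → ((- (2 + P)) - (- (1 + P))) * a + ((0 - (- 1)) * b + (Q - Q) * (b + (b - a))) ≡ b - a
            Δ = ℤSolver.solve-∀
    climb→climb : ∀ p q → V (- + suc (suc (suc p))) 0 (+ q) < V (- + p) (- 2) (+ suc q)
    climb→climb p q = V-< (- + suc (suc (suc p))) 0 (+ q) (- + p) (- 2) (+ suc q) 0<2a (Δ (+ p) (+ q) a b)
      where Δ : ∀ P Q a b → ((- P) - (- (3 + P))) * a + (((- 2) - 0) * b + ((1 + Q) - Q) * (b + (b - a))) ≡ a + a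
            Δ = ℤSolver.solve-∀
    climb→summit : V (- 2) 0 (+ suc h₃) < V (- 1) 2 (+ h₃)
    climb→summit = V-< (- 2) 0 (+ suc h₃) (- 1) 2 (+ h₃) 0<2a (Δ (+ h₃) a b)
      where Δ : ∀ H a b → ((- 1) - (- 2)) * a + ((2 - 0) * b + (H - (1 + H)) * (b + (b - a))) ≡ a + a
            Δ = ℤSolver.solve-∀

    summit↗ : Linked _<_ summit
    summit↗ = step₁ ∷ step₂ ∷ step₃ ∷ step₄ ∷ step₅ ∷ [-]
      where
      H : ℤ
      H = + suc (suc h₃)
      step₁ : V (- 1) 2 (+ h₃) < V 0 (- 1) H
      step₁ = V-< (- 1) 2 (+ h₃) 0 (- 1) H 0<b-a (Δ (+ h₃) a b)
        where Δ : ∀ H a b → (0 - (- 1)) * a + (((- 1) - 2) * b + ((2 + H) - H) * (b + (b - a))) ≡ b - a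
              Δ = ℤSolver.solve-∀
      step₂ : V 0 (- 1) H < V (- 1) 0 H
      step₂ = V-< 0 (- 1) H (- 1) 0 H 0<b-a (Δ H a b)
        where Δ : ∀ H a b → ((- 1) - 0) * a + ((0 - (- 1)) * b + (H - H) * (b + (b - a))) ≡ b - a
              Δ = ℤSolver.solve-∀
      step₃ : V (- 1) 0 H < V 1 0 H
      step₃ = V-< (- 1) 0 H 1 0 H 0<2a (Δ H a b)
        where Δ : ∀ H a b → (1 - (- 1)) * a + ((0 - 0) * b + (H - H) * (b + (b - a))) ≡ a + a
              Δ = ℤSolver.solve-∀
      step₄ : V 1 0 H < V 0 1 H
      step₄ = V-< 1 0 H 0 1 H 0<b-a (Δ H a b)
        where Δ : ∀ H a b → (0 - 1) * a + ((1 - 0) * b + (H - H) * (b + (b - a))) ≡ b - a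
              Δ = ℤSolver.solve-∀
      step₅ : V 0 1 H < V 0 0 (+ h)
      step₅ = V-< 0 1 H 0 0 (+ h) 0<b-a (Δ H a b)
        where Δ : ∀ H a b → (0 - 0) * a + ((0 - 1) * b + ((1 + H) - H) * (b + (b - a))) ≡ b - a
              Δ = ℤSolver.solve-∀

    chain↗ : Linked _<_ chain
    chain↗ =
      Linked-antidiagonal descent (λ _ _ → [-]) (λ p q → just (descent↗ p q)) h 0 (ℕₚ.+-identityʳ h) (just descent→retreat)
      (Linked-antidiagonal retreat (λ _ _ → [-]) (λ p q → just (retreat↗ p q))
        (suc (suc h₃)) 1 (ℕₚ.+-comm (suc (suc h₃)) 1) (just retreat→climb)
      (Linked-antidiagonal climb (λ p q → climb↗₁ p q ∷ climb↗₂ p q ∷ [-]) (λ p q → just (climb→climb p q))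
        h₃ 1 (ℕₚ.+-comm h₃ 1) (just climb→summit)
      summit↗))

    chain-signed : All (SignedSum h (c ∷ b ∷ a ∷ [])) chain
    chain-signed =
      All-antidiagonal descent (λ {p} {q} e → SignedSum-V 0 (- + q) (- + p) refl (∣-+∣ q) (∣-+∣ p) (trans (ℕₚ.+-comm q p) e) ∷ [])
        h 0 (ℕₚ.+-identityʳ h)
      (All-antidiagonal retreat (λ {p} {q} e → SignedSum-V (- + q) (- + p) 0 (∣-+∣ q) (∣-+∣ p) refl
                                                 (trans (ℕₚ.+-identityʳ _) (trans (ℕₚ.+-comm q p) e)) ∷ [])
        (suc (suc h₃)) 1 (ℕₚ.+-comm (suc (suc h₃)) 1)
      (All-antidiagonal climb (λ {p} {q} e → SignedSum-V (- + p) (- 2) (+ q) (∣-+∣ p) refl refl (trans (weight₁ p q) (cong (2 ℕ.+_) e))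
                                           ∷ SignedSum-V (- + suc p) (- 1) (+ q) refl refl refl (trans (weight₂ p q) (cong (2 ℕ.+_) e))
                                           ∷ SignedSum-V (- + suc (suc p)) 0 (+ q) refl refl refl (trans (weight₃ p q) (cong (2 ℕ.+_) e)) ∷ [])
        h₃ 1 (ℕₚ.+-comm h₃ 1)
      (SignedSum-V (- 1) 2 (+ h₃) refl refl refl refl ∷ SignedSum-V 0 (- 1) (+ suc (suc h₃)) refl refl refl refl
        ∷ SignedSum-V (- 1) 0 (+ suc (suc h₃)) refl refl refl refl ∷ SignedSum-V 1 0 (+ suc (suc h₃)) refl refl refl refl
        ∷ SignedSum-V 0 1 (+ suc (suc h₃)) refl refl refl refl ∷ SignedSum-V 0 0 (+ h) refl refl refl refl ∷ [])))
      where
      ∣-+∣ : ∀ n → ∣ - + n ∣ ≡ n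
      ∣-+∣ n = ℤₚ.∣-i∣≡∣i∣ (+ n)
      weight₁ : ∀ p q → p ℕ.+ 2 ℕ.+ q ≡ 2 ℕ.+ (p ℕ.+ q)
      weight₁ = ℕSolver.solve-∀
      weight₂ : ∀ p q → suc p ℕ.+ 1 ℕ.+ q ≡ 2 ℕ.+ (p ℕ.+ q)
      weight₂ = ℕSolver.solve-∀
      weight₃ : ∀ p q → suc (suc p) ℕ.+ 0 ℕ.+ q ≡ 2 ℕ.+ (p ℕ.+ q)
      weight₃ = ℕSolver.solve-∀

    length-chain : length chain ≡ 5 ℕ.* h ℕ.+ 1
    length-chain = trans (length-antidiagonal descent h 0 _)
      (trans (cong (1 ℕ.* suc h ℕ.+_) (length-antidiagonal retreat (suc (suc h₃)) 1 _))
      (trans (cong (λ n → 1 ℕ.* suc h ℕ.+ (1 ℕ.* h ℕ.+ n)) (length-antidiagonal climb h₃ 1 summit)) (count h₃)))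
      where count : ∀ x → 1 ℕ.* (4 ℕ.+ x) ℕ.+ (1 ℕ.* (3 ℕ.+ x) ℕ.+ (3 ℕ.* (1 ℕ.+ x) ℕ.+ 6)) ≡ 5 ℕ.* (3 ℕ.+ x) ℕ.+ 1
            count = ℕSolver.solve-∀

  mirroredChain : ∀ {h₁ ys x xs} → Linked _<_ (x ∷ xs) → 0 < x → All (SignedSum (suc h₁) ys) (x ∷ xs) →
                  length (x ∷ xs) ≡ 3 ℕ.* suc h₁ → DistinctSignedSums (suc h₁) ys (minSize (suc h₁) 3)
  mirroredChain {h₁} {x = x} {xs} xs↗ 0<x xs-signed length≡3h =
    DistinctSignedSums-≤ 5h+1≤6h (symmetricSums xs↗ (Linkedₚ.Linked⇒All ℤₚ.<-trans 0<x xs↗) xs-signed)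
    where
    5h+1≤6h : minSize (suc h₁) 3 ℕ.≤ length (x ∷ xs) ℕ.+ length (x ∷ xs)
    5h+1≤6h = subst₂ ℕ._≤_ (sym (minSize-3 (suc h₁))) (trans (six h₁) (sym (cong₂ ℕ._+_ length≡3h length≡3h)))
      (ℕₚ.m≤m+n (5 ℕ.* suc h₁ ℕ.+ 1) h₁)
      where
      six : ∀ x → 5 ℕ.* (1 ℕ.+ x) ℕ.+ 1 ℕ.+ x ≡ 3 ℕ.* (1 ℕ.+ x) ℕ.+ 3 ℕ.* (1 ℕ.+ x)
      six = ℕSolver.solve-∀

  threeElements : ∀ h₃ {a b c} → 0 < a → a < b → b < c →
                  DistinctSignedSums (3 ℕ.+ h₃) (c ∷ b ∷ a ∷ []) (minSize (3 ℕ.+ h₃) 3)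
  threeElements h₃ {a} {b} {c} 0<a a<b b<c with ℤₚ.<-cmp (c - b) (b - a)
  ... | tri< t<s _ _ = mirroredChain chain↗ (V-pos (suc (suc h₃)) 0<a) chain-signed length-chain
    where
    open ThreeElements a b c using (V-pos)
    open GapsDecreasing a b c (suc h₃) (0<-gap a<b) (0<-gap b<c) (0<-gap t<s)
  ... | tri> _ _ s<t = mirroredChain chain↗ (V-pos (suc (suc h₃)) 0<a) chain-signed length-chain
    where
    open ThreeElements a b c using (V-pos)
    open GapsIncreasing a b c (suc h₃) (0<-gap a<b) (0<-gap b<c) (0<-gap s<t)
  ... | tri≈ _ t≡s _ = subst (λ c → DistinctSignedSums (3 ℕ.+ h₃) (c ∷ b ∷ a ∷ []) (minSize (3 ℕ.+ h₃) 3)) (sym c≡b+s)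
      (distinct chain (increasing⇒Unique chain↗) chain-signed (ℕₚ.≤-reflexive (trans (minSize-3 (3 ℕ.+ h₃)) (sym length-chain))))
    where
    open GapsEqual a b h₃ 0<a (0<-gap a<b) using (chain; chain↗; chain-signed; length-chain)
    c≡b+s : c ≡ b + (b - a)
    c≡b+s = trans (split b c) (cong (λ t → b + t) t≡s)
      where
      split : ∀ b c → c ≡ b + (c - b)
      split = ℤSolver.solve-∀

  extendByLargest : ∀ {h₁ m m′ ys n} → m′ < m → 0 ≤ m′ → All (λ y → ∣ y ∣ ℕ.≤ ∣ m′ ∣) ys →
    DistinctSignedSums (suc h₁) (m′ ∷ ys) n → DistinctSignedSums (suc h₁) (m ∷ m′ ∷ ys) ((suc h₁ ℕ.+ suc h₁) ℕ.+ n)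
  extendByLargest {h₁} {m} {m′} {ys} {n} m′<m 0≤m′ ys≤m′ old =
    DistinctSignedSums-≤ (ℕₚ.≤-reflexive (cong (λ k → (k ℕ.+ k) ℕ.+ n) (sym length-new)))
      (DistinctSignedSums-++ B (symmetricSums new↗ new>0 new-signed) (DistinctSignedSums-skip m old)
        (Allₚ.++⁺ (Allₚ.map⁺ (All.map (λ {y} B<∣y∣ → subst (B ℕ.<_) (sym (ℤₚ.∣-i∣≡∣i∣ y)) B<∣y∣) new>B)) new>B)
        (All.map (SignedSum-∣∣≤ ∣ m′ ∣ (ℕₚ.≤-refl ∷ ys≤m′)) (DistinctSignedSums.sums-signed old)))
    where
    h : ℕ
    h = suc h₁
    B : ℕ
    B = h ℕ.* ∣ m′ ∣
    point : ℕ → ℕ → Vec ℤ 1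
    point p q = + q * m + (+ p * m′ + 0) ∷ []
    new : List ℤ
    new = antidiagonal point h₁ 1 []
    length-new : length new ≡ h
    length-new = trans (length-antidiagonal point h₁ 1 []) (trans (ℕₚ.+-identityʳ _) (ℕₚ.*-identityˡ h))
    new↗ : Linked _<_ new
    new↗ = Linked-antidiagonal point (λ _ _ → [-]) (λ p q → just (<-by (0<-gap m′<m) (shift (+ p) (+ q) m m′)))
      h₁ 1 (ℕₚ.+-comm h₁ 1) just-nothing []
      where
      shift : ∀ P Q m m′ → (1 + Q) * m + (P * m′ + 0) ≡ (Q * m + ((1 + P) * m′ + 0)) + (m - m′)
      shift = ℤSolver.solve-∀
    B<first : + B < 1 * m + (+ h₁ * m′ + 0)
    B<first = <-by (0<-gap m′<m) (trans (shift (+ h₁) m m′) (cong (λ b → b + (m - m′)) B≡))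
      where
      shift : ∀ H m m′ → 1 * m + (H * m′ + 0) ≡ (1 + H) * m′ + (m - m′)
      shift = ℤSolver.solve-∀
      B≡ : + h * m′ ≡ + B
      B≡ = trans (cong (+ h *_) (sym (ℤₚ.0≤i⇒+∣i∣≡i 0≤m′))) (sym (ℤₚ.pos-* h ∣ m′ ∣))
    new>B+ : All (+ B <_) new
    new>B+ = Linkedₚ.Linked⇒All ℤₚ.<-trans B<first new↗
    new>B : All (λ y → B ℕ.< ∣ y ∣) new
    new>B = All.map +<⇒<∣∣ new>B+
    new>0 : All (0 <_) new
    new>0 = All.map (ℤₚ.≤-<-trans (+≤+ z≤n)) new>B+
    new-signed : All (SignedSum h (m ∷ m′ ∷ ys)) new
    new-signed = All-antidiagonal point
      (λ {p} {q} e → cons (+ q) (cons (+ p) (SignedSum-zero ys) (sym (ℕₚ.+-identityʳ p)) refl)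
                                (sym (trans (ℕₚ.+-comm q p) e)) refl ∷ [])
      h₁ 1 (ℕₚ.+-comm h₁ 1) []

  descendingSums : ∀ h₃ ys → Linked _>_ ys → All (0 <_) ys → 3 ℕ.≤ length ys →
                   DistinctSignedSums (3 ℕ.+ h₃) ys (minSize (3 ℕ.+ h₃) (length ys))
  descendingSums h₃ (c ∷ b ∷ a ∷ []) (b<c ∷ a<b ∷ [-]) (_ ∷ _ ∷ 0<a ∷ []) _ = threeElements h₃ 0<a a<b b<c
  descendingSums h₃ (m ∷ ys@(m′ ∷ y ∷ z ∷ zs)) (m′<m ∷ ys↘@(y<m′ ∷ y↘)) (_ ∷ ys>0@(0<m′ ∷ y>0)) _ =
    subst (DistinctSignedSums (3 ℕ.+ h₃) (m ∷ ys)) (sym (minSize-step (3 ℕ.+ h₃) (suc (suc (length zs)))))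
      (extendByLargest m′<m (ℤₚ.<⇒≤ 0<m′) y≤m′ (descendingSums h₃ ys ys↘ ys>0 (s≤s (s≤s (s≤s z≤n)))))
    where
    y≤m′ : All (λ x → ∣ x ∣ ℕ.≤ ∣ m′ ∣) (y ∷ z ∷ zs)
    y≤m′ = All.zipWith (λ (0<x , x<m′) → ∣∣-mono-≤ (ℤₚ.<⇒≤ 0<x) (ℤₚ.<⇒≤ x<m′))
      (y>0 , Linkedₚ.Linked⇒All (λ y>x z<y → ℤₚ.<-trans z<y y>x) y<m′ y↘)
  descendingSums h₃ [] _ _ ()
  descendingSums h₃ (_ ∷ []) _ _ (s≤s ())
  descendingSums h₃ (_ ∷ _ ∷ []) _ _ (s≤s (s≤s ()))

  sortDescending : ∀ {k} (a : Fin k → ℤ) → Injective _≡_ _≡_ a →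
                   Σ (List ℤ) λ ys → Linked _>_ ys × ys ↭ tabulate a
  sortDescending a a-inj = sort (tabulate a) , strictly (sort-↗ (tabulate a)) sorted! , sort-↭ (tabulate a)
    where
    open import Data.List.Sort (Flip.decTotalOrder ℤₚ.≤-decTotalOrder) using (sort; sort-↭; sort-↗)
    sorted! : Unique (sort (tabulate a))
    sorted! = ↭ₛₚ.Unique-resp-↭ (setoid ℤ) (↭.↭⇒↭ₛ (↭.↭-sym (sort-↭ (tabulate a)))) (Uniqueₚ.tabulate⁺ a-inj)
    strictly : ∀ {ys} → Linked (λ x y → y ≤ x) ys → Unique ys → Linked _>_ ys
    strictly []                 _            = []
    strictly [-]                _            = [-]
    strictly (y≤x ∷ ys↘) ((x≢ ∷ _) ∷ ys!) = ℤₚ.≤∧≢⇒< y≤x (x≢ ∘ sym) ∷ strictly ys↘ ys!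

  SignedSumset-lowerBound : ∀ {k} h → 3 ℕ.≤ h → 3 ℕ.≤ k → (a : Fin k → ℤ) → Injective _≡_ _≡_ a → (∀ i → 0 < a i) →
                            ∃ λ n → HasCard (SignedSumset h a) n × minSize h k ℕ.≤ n
  SignedSumset-lowerBound {k} h@(suc (suc (suc h₃))) (s≤s (s≤s (s≤s _))) 3≤k a a-inj a>0
    with ys , ys↘ , ys↭a ← sortDescending a a-inj
    with n , card ← SignedSumset-finite h a
    = n , card , subst (λ ℓ → minSize h ℓ ℕ.≤ n) length-ys (DistinctSignedSums⇒≤card sums ys↭a card)
    where
    length-ys : length ys ≡ k
    length-ys = trans (↭ₚ.↭-length ys↭a) (Listₚ.length-tabulate a)
    sums : DistinctSignedSums h ys (minSize h (length ys))
    sums = descendingSums h₃ ys ys↘ (↭ₚ.All-resp-↭ (↭.↭-sym ys↭a) (Allₚ.tabulate⁺ a>0))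
                                    (subst (3 ℕ.≤_) (sym length-ys) 3≤k)

  odds : ∀ {k} → Fin k → ℤ
  odds i = + (2 ℕ.* toℕ i ℕ.+ 1)

  odds-injective : ∀ {k} → Injective _≡_ _≡_ (odds {k})
  odds-injective {x = i} {j} e =
    Finₚ.toℕ-injective (ℕₚ.*-cancelˡ-≡ (toℕ i) (toℕ j) 2 (ℕₚ.+-cancelʳ-≡ 1 _ _ (ℤₚ.+-injective e)))

  odds-positive : ∀ {k} (i : Fin k) → 0 < odds i
  odds-positive i = +<+ (ℕₚ.m≤n+m 1 (2 ℕ.* toℕ i))

  odds-odd : ∀ {k} → All Odd (tabulate (odds {k}))
  odds-odd = Allₚ.tabulate⁺ (λ i → + toℕ i , cong +_ (double (toℕ i)))
    where
    double : ∀ t → 2 ℕ.* t ℕ.+ 1 ≡ t ℕ.+ t ℕ.+ 1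
    double = ℕSolver.solve-∀

  odds-bounded : ∀ {k₁} → All (λ y → ∣ y ∣ ℕ.≤ 2 ℕ.* k₁ ℕ.+ 1) (tabulate (odds {suc k₁}))
  odds-bounded = Allₚ.tabulate⁺ {f = odds} (λ i → ℕₚ.+-monoˡ-≤ 1 (ℕₚ.*-monoʳ-≤ 2 (Finₚ.toℕ≤pred[n] i)))

  evenGrid : (C : ℕ) → Fin (suc C) → ℤ
  evenGrid C j = + (toℕ j ℕ.+ toℕ j) - + C

  evenGrid-covers : ∀ {x C} → - + C ≤ x → x ≤ + C → (∃ λ Q → x + + C ≡ Q + Q) → ∃ λ j → evenGrid C j ≡ x
  evenGrid-covers {x} {C} -C≤x x≤C (+ j , x+C≡) = fromℕ< (s≤s j≤C) , (begin
    evenGrid C (fromℕ< (s≤s j≤C)) ≡⟨ cong (λ t → + (t ℕ.+ t) - + C) (Finₚ.toℕ-fromℕ< (s≤s j≤C)) ⟩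
    + (j ℕ.+ j) - + C             ≡⟨ cong (_- + C) x+C≡ ⟨
    x + + C - + C                 ≡⟨ cancel x (+ C) ⟩
    x                             ∎)
    where
    open ≡-Reasoning
    j+j≤C+C : j ℕ.+ j ℕ.≤ C ℕ.+ C
    j+j≤C+C = ℤₚ.drop‿+≤+ (subst (_≤ + (C ℕ.+ C)) x+C≡ (ℤₚ.+-monoˡ-≤ (+ C) x≤C))
    j≤C : j ℕ.≤ C
    j≤C = ℕₚ.≮⇒≥ (λ C<j → ℕₚ.<⇒≱ (ℕₚ.+-mono-< C<j C<j) j+j≤C+C)
    cancel : ∀ x c → x + c - c ≡ x
    cancel = ℤSolver.solve-∀
  evenGrid-covers {x} {C} -C≤x x≤C (-[1+ n ] , x+C≡)
    with () ← subst (0 ≤_) x+C≡ (subst (_≤ x + + C) (ℤₚ.+-inverseˡ (+ C)) (ℤₚ.+-monoˡ-≤ (+ C) -C≤x))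

  module _ (h k₁ : ℕ) where

    C : ℕ
    C = h ℕ.* (2 ℕ.* k₁ ℕ.+ 1)

    parity⇒C-parity : ∀ {x} → (∃ λ q → x + + h ≡ q + q) → ∃ λ Q → x + + C ≡ Q + Q
    parity⇒C-parity {x} (q , x+h≡q+q) = q + + K , (begin
      x + + C                  ≡⟨ cong (λ n → x + + n) (split h k₁) ⟩
      x + (+ h + (+ K + + K))  ≡⟨ ℤₚ.+-assoc x (+ h) _ ⟨
      x + + h + (+ K + + K)    ≡⟨ cong (_+ (+ K + + K)) x+h≡q+q ⟩
      q + q + (+ K + + K)      ≡⟨ interleave q (+ K) ⟩
      (q + + K) + (q + + K)    ∎)
      where
      open ≡-Reasoning
      K : ℕ
      K = h ℕ.* k₁
      split : ∀ h k₁ → h ℕ.* (2 ℕ.* k₁ ℕ.+ 1) ≡ h ℕ.+ (h ℕ.* k₁ ℕ.+ h ℕ.* k₁)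
      split = ℕSolver.solve-∀
      interleave : ∀ q K → q + q + (K + K) ≡ (q + K) + (q + K)
      interleave = ℤSolver.solve-∀

    oddSumset-covered : ∀ {x} → SignedSumset h (odds {suc k₁}) x → ∃ λ j → evenGrid C j ≡ x
    oddSumset-covered {x} x∈ =
      evenGrid-covers (proj₁ (∣∣≤⇒bounds ∣x∣≤C)) (proj₂ (∣∣≤⇒bounds ∣x∣≤C)) (parity⇒C-parity {x} (SignedSum-parity odds-odd x∈′))
      where
      x∈′ : SignedSum h (tabulate odds) x
      x∈′ = fromSignedSumset odds x∈
      ∣x∣≤C : ∣ x ∣ ℕ.≤ C
      ∣x∣≤C = SignedSum-∣∣≤ _ odds-bounded x∈′

    oddSumset-card≤ : ∀ {n} → HasCard (SignedSumset h (odds {suc k₁})) n → n ℕ.≤ suc C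
    oddSumset-card≤ card = cover⇒card≤ card (evenGrid C) oddSumset-covered

    minSize≡suc-C : minSize h (suc k₁) ≡ suc C
    minSize≡suc-C = trans (minSize-suc h k₁) (regroup h k₁)
      where
      regroup : ∀ h k₁ → 2 ℕ.* h ℕ.* k₁ ℕ.+ h ℕ.+ 1 ≡ 1 ℕ.+ h ℕ.* (2 ℕ.* k₁ ℕ.+ 1)
      regroup = ℕSolver.solve-∀

  oddSumset-card : ∀ h k → 3 ℕ.≤ h → 3 ℕ.≤ k → HasCard (SignedSumset h (odds {k})) (minSize h k)
  oddSumset-card h k@(suc k₁) 3≤h 3≤k
    with n , card , minSize≤n ← SignedSumset-lowerBound h 3≤h 3≤k odds odds-injective odds-positive
    = subst (HasCard (SignedSumset h odds)) n≡minSize card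
    where
    n≡minSize : n ≡ minSize h k
    n≡minSize = ℕₚ.≤-antisym (subst (n ℕ.≤_) (sym (minSize≡suc-C h k₁)) (oddSumset-card≤ h k₁ card)) minSize≤n

open SignedSums using (SignedSumset-lowerBound; oddSumset-card)

open import Defs
open import Data.Nat using (ℕ; _≤_; _+_; _*_; _∸_)
open import Data.Integer using (ℤ; +_)
import Data.Integer as Z
open import Data.Fin using (Fin; toℕ)
open import Data.Product using (∃; _×_; _,_)
open import Function.Definitions using (Injective)
open import Relation.Binary.PropositionalEquality using (_≡_)

theorem3 : (h k : ℕ) → 3 ≤ h → 3 ≤ k →
    ((a : Fin k → ℤ) → Injective {A = Fin k} {B = ℤ} _≡_ _≡_ a → ((i : Fin k) → + 0 Z.< a i) →
    ∃ λ n → HasCard (SignedSumset h a) n × (2 * h * k ∸ h + 1 ≤ n))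
    × HasCard (SignedSumset {k} h (λ (i : Fin k) → + (2 * toℕ i + 1))) (2 * h * k ∸ h + 1)
theorem3 h k 3≤h 3≤k = SignedSumset-lowerBound h 3≤h 3≤k , oddSumset-card h k 3≤h 3≤k
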